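{- Define polynomials $p_n(x,y,z)$ by \[ \sum_{n=0}^\infty p_n(x,y,z)q^n=\prod_{j=0}^\infty\left(1+xq^{2^j}\right)\left(1+yq^{2^j}+zq^{2\cdot 2^j}\right), \] and set $Q_n(Z)=p_{2^{n+1}-2}(z,z,z)$ and $R_n(Z)=p_{2^n-1}(z,z,z)$, polynomials in the single variable $z$. Let $F_m$ denote the Fibonacci numbers ($F_1=F_2=1$, $F_{m+1}=F_m+F_{m-1}$). Then for each $n\ge1$: (a) $Q_n(Z)$ is monic of degree $2n$, and its lowest-degree term has degree $n$; (b) the coefficient of $z^{2n-1}$ in $Q_n(Z)$ is $n+2$; (c) the coefficient of $z^n$ in $Q_n(Z)$ is $F_{2n+2}$. For each $n\ge 3$: (d) $R_n(Z)$ is monic of degree $2n-2$, and its lowest-degree term has degree $n$; (e) for $n\ge 4$, the coefficient of $z^{2n-3}$ in $R_n(Z)$ is $n+2$; (f) the coefficient of $z^n$ in $R_n(Z)$ is $F_{2n+1}$. -}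

module Defs where

open import Data.Nat using (ℕ; zero; suc; _+_; _*_; _∸_; _^_; _≤_; _<_; _≟_)
open import Data.Bool using (Bool; true; false; _∧_; if_then_else_)
open import Relation.Nullary.Decidable using (⌊_⌋)
open import Relation.Binary.PropositionalEquality using (_≡_; _≢_)
open import Data.Product using (_×_)

sumTo : ℕ → (ℕ → ℕ) → ℕ
sumTo zero    f = f 0
sumTo (suc n) f = sumTo n f + f (suc n)

-- Polynomials in x, y, z with ℕ coefficients:
-- P a b c = coefficient of x^a y^b z^c (only finitely many nonzero in our uses).
Poly3 : Set
Poly3 = ℕ → ℕ → ℕ → ℕ

_+P_ : Poly3 → Poly3 → Poly3
(P +P Q) a b c = P a b c + Q a b c

_*P_ : Poly3 → Poly3 → Poly3
(P *P Q) a b c =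
  sumTo a λ a₁ → sumTo b λ b₁ → sumTo c λ c₁ →
    P a₁ b₁ c₁ * Q (a ∸ a₁) (b ∸ b₁) (c ∸ c₁)

zeroP : Poly3
zeroP _ _ _ = 0

-- Formal power series in q with coefficients in ℕ[x,y,z]:
-- S n = coefficient of q^n.
Series : Set
Series = ℕ → Poly3

sumP : ℕ → (ℕ → Poly3) → Poly3
sumP zero    f = f 0
sumP (suc n) f = sumP n f +P f (suc n)

_*S_ : Series → Series → Series
(S *S T) n = sumP n λ m → S m *P T (n ∸ m)

monoS : ℕ → ℕ → ℕ → ℕ → Series
monoS a b c e n a' b' c' =
  if ⌊ n ≟ e ⌋ ∧ ⌊ a' ≟ a ⌋ ∧ ⌊ b' ≟ b ⌋ ∧ ⌊ c' ≟ c ⌋ then 1 else 0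

_+S_ : Series → Series → Series
(S +S T) n = S n +P T n

oneS : Series
oneS = monoS 0 0 0 0

factor : ℕ → Series
factor j = (oneS +S monoS 1 0 0 (2 ^ j))
        *S (oneS +S (monoS 0 1 0 (2 ^ j) +S monoS 0 0 1 (2 * 2 ^ j)))

prodTo : ℕ → Series
prodTo zero    = oneS
prodTo (suc J) = prodTo J *S factor J

-- Factors with
-- j ≥ n+1 have 2^j > n and so are ≡ 1 mod q^{n+1}; hence the coefficient of
-- q^n of the infinite product equals that of the finite product over j ≤ n.
p : ℕ → Poly3
p n = prodTo (suc n) n

Poly1 : Set
Poly1 = ℕ → ℕ

-- P(z,z,z): coefficient of z^k is Σ_{a+b+c=k} P a b c
diag : Poly3 → Poly1
diag P k = sumTo k λ a → sumTo (k ∸ a) λ b → P a b (k ∸ a ∸ b)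

Q : ℕ → Poly1
Q n = diag (p (2 ^ (suc n) ∸ 2))

R : ℕ → Poly1
R n = diag (p (2 ^ n ∸ 1))

MonicOfDegree : Poly1 → ℕ → Set
MonicOfDegree P d = (P d ≡ 1) × (∀ k → d < k → P k ≡ 0)

LowestDegree : Poly1 → ℕ → Set
LowestDegree P d = (P d ≢ 0) × (∀ k → k < d → P k ≡ 0)

fib : ℕ → ℕ
fib 0 = 0
fib 1 = 1
fib (suc (suc n)) = fib (suc n) + fib n

-- The generating function G(q) = ∏ⱼ (1 + x q^(2^j)) (1 + y q^(2^j) + z q^(2·2^j)) satisfies
-- G(q) = (1 + x q)(1 + y q + z q²) G(q²), so
--   p(2m) = p(m) + (z + x y) p(m - 1)   and   p(2m + 1) = (x + y) p(m) + x z p(m - 1)   (p(-1) = 0).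
-- Since 2^(n+2) - 2 = 2 (2^(n+1) - 1) and 2^(n+2) - 1 = 2 (2^(n+1) - 1) + 1, setting x = y = z gives
--   Q(n+1) = R(n+1) + z Q(n) + z² Q(n)   and   R(n+2) = 2 z R(n+1) + z² Q(n),
-- from which the support, the top two coefficients and the lowest coefficient of Q(n) and R(n)
-- follow by induction; the lowest coefficients obey the Fibonacci recurrence.

module Submission where

open import Algebra.Bundles using (CommutativeSemiring)
import Algebra.Structures.Biased as Biased
open import Data.Bool using (if_then_else_)
open import Data.Nat using (ℕ; zero; suc; _+_; _*_; _^_; _∸_; _≤_; _<_; _≤′_; ≤′-refl; ≤′-step; z≤n; s≤s; _≟_)
import Data.Nat.Properties as ℕₚ
open import Data.Product using (_×_; _,_; proj₁; proj₂)
open import Data.Sum using (inj₁; inj₂)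
open import Function using (_∘_)
open import Relation.Binary using (Rel; IsEquivalence)
import Relation.Binary.Reasoning.Setoid
open import Relation.Binary.PropositionalEquality as ≡ using (_≡_; _≢_; _≗_)
open import Relation.Nullary using (yes; no; contradiction)
open import Relation.Nullary.Decidable using (⌊_⌋)

double : ℕ → ℕ
double zero    = zero
double (suc n) = suc (suc (double n))

data EvenOdd : ℕ → Set where
  even : ∀ m → EvenOdd (double m)
  odd  : ∀ m → EvenOdd (suc (double m))

evenOdd : ∀ n → EvenOdd n
evenOdd zero = even zero
evenOdd (suc n) with evenOdd n
... | even m = odd m
... | odd m  = even (suc m)

double≡2* : ∀ n → double n ≡ 2 * n
double≡2* zero    = ≡.refl
double≡2* (suc n) = ≡.cong suc (≡.trans (≡.cong suc (double≡2* n)) (≡.sym (ℕₚ.+-suc n (n + 0))))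

n≤double : ∀ n → n ≤ double n
n≤double zero    = z≤n
n≤double (suc n) = s≤s (ℕₚ.m≤n⇒m≤1+n (n≤double n))

n<2^n : ∀ n → n < 2 ^ n
n<2^n zero    = s≤s z≤n
n<2^n (suc n) = ℕₚ.+-mono-≤-< (ℕₚ.m^n>0 2 n) (ℕₚ.<-≤-trans (n<2^n n) (ℕₚ.m≤m+n (2 ^ n) 0))

double-injective : ∀ {m n} → double m ≡ double n → m ≡ n
double-injective {zero}  {zero}  _  = ≡.refl
double-injective {suc m} {suc n} eq = ≡.cong suc (double-injective (ℕₚ.suc-injective (ℕₚ.suc-injective eq)))

double≢odd : ∀ m n → double m ≢ suc (double n)
double≢odd (suc m) (suc n) eq = double≢odd m n (ℕₚ.suc-injective (ℕₚ.suc-injective eq))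

double-∸ : ∀ m n → double m ∸ double n ≡ double (m ∸ n)
double-∸ m       zero    = ≡.refl
double-∸ zero    (suc n) = ≡.refl
double-∸ (suc m) (suc n) = double-∸ m n

odd-∸-double : ∀ {m n} → n ≤ m → suc (double m) ∸ double n ≡ suc (double (m ∸ n))
odd-∸-double {m}     {zero}  _         = ≡.refl
odd-∸-double {suc m} {suc n} (s≤s n≤m) = odd-∸-double n≤m

double-≤-odd : ∀ {m n} → double n ≤ suc (double m) → n ≤ m
double-≤-odd {m}     {zero}  _                 = z≤n
double-≤-odd {suc m} {suc n} (s≤s (s≤s 2n≤2m+1)) = s≤s (double-≤-odd 2n≤2m+1)

-- Formal power series over a commutative semiring

module PowerSeries {c ℓ} (𝓡 : CommutativeSemiring c ℓ) where
  open CommutativeSemiring 𝓡 renaming (_+_ to _⊕_; _*_ to _⊗_) hiding (zero)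
  open import Relation.Binary.Reasoning.Setoid setoid
  open import Algebra.Properties.CommutativeSemigroup +-commutativeSemigroup using (interchange)

  Σ : ℕ → (ℕ → Carrier) → Carrier
  Σ zero    f = f 0
  Σ (suc n) f = Σ n f ⊕ f (suc n)

  Σ-cong : ∀ n {f g} → (∀ i → i ≤ n → f i ≈ g i) → Σ n f ≈ Σ n g
  Σ-cong zero    f≈g = f≈g 0 z≤n
  Σ-cong (suc n) f≈g = +-cong (Σ-cong n λ i i≤n → f≈g i (ℕₚ.m≤n⇒m≤1+n i≤n)) (f≈g (suc n) ℕₚ.≤-refl)

  Σ-zero : ∀ n {f} → (∀ i → i ≤ n → f i ≈ 0#) → Σ n f ≈ 0#
  Σ-zero zero    f≈0 = f≈0 0 z≤n
  Σ-zero (suc n) f≈0 = trans (+-cong (Σ-zero n λ i i≤n → f≈0 i (ℕₚ.m≤n⇒m≤1+n i≤n)) (f≈0 (suc n) ℕₚ.≤-refl))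
                             (+-identityˡ 0#)

  Σ-single : ∀ n k {f} → k ≤ n → (∀ i → i ≤ n → i ≢ k → f i ≈ 0#) → Σ n f ≈ f k
  Σ-single zero    zero z≤n _ = refl
  Σ-single (suc n) k {f} k≤1+n others with k ≟ suc n
  ... | yes ≡.refl = trans (+-cong (Σ-zero n λ i i≤n → others i (ℕₚ.m≤n⇒m≤1+n i≤n) (ℕₚ.<⇒≢ (s≤s i≤n))) refl)
                           (+-identityˡ (f k))
  ... | no k≢1+n   = trans (+-cong (Σ-single n k k≤n λ i i≤n → others i (ℕₚ.m≤n⇒m≤1+n i≤n))
                                   (others (suc n) ℕₚ.≤-refl (k≢1+n ∘ ≡.sym)))
                           (+-identityʳ (f k))
    where
    k≤n : k ≤ n
    k≤n = ℕₚ.≤-pred (ℕₚ.≤∧≢⇒< k≤1+n k≢1+n)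

  Σ-⊕ : ∀ n f g → Σ n (λ i → f i ⊕ g i) ≈ Σ n f ⊕ Σ n g
  Σ-⊕ zero    f g = refl
  Σ-⊕ (suc n) f g = trans (+-cong (Σ-⊕ n f g) refl) (interchange _ _ _ _)

  ⊗-distribˡ-Σ : ∀ n a f → a ⊗ Σ n f ≈ Σ n (λ i → a ⊗ f i)
  ⊗-distribˡ-Σ zero    a f = refl
  ⊗-distribˡ-Σ (suc n) a f = trans (distribˡ a _ _) (+-cong (⊗-distribˡ-Σ n a f) refl)

  ⊗-distribʳ-Σ : ∀ n a f → Σ n f ⊗ a ≈ Σ n (λ i → f i ⊗ a)
  ⊗-distribʳ-Σ zero    a f = refl
  ⊗-distribʳ-Σ (suc n) a f = trans (distribʳ a _ _) (+-cong (⊗-distribʳ-Σ n a f) refl)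

  Σ-head : ∀ n f → Σ (suc n) f ≈ f 0 ⊕ Σ n (λ i → f (suc i))
  Σ-head zero    f = refl
  Σ-head (suc n) f = trans (+-cong (Σ-head n f) refl) (+-assoc _ _ _)

  Σ-reverse : ∀ n f → Σ n f ≈ Σ n (λ i → f (n ∸ i))
  Σ-reverse zero    f = refl
  Σ-reverse (suc n) f = begin
    Σ n f ⊕ f (suc n)                    ≈⟨ +-comm _ _ ⟩
    f (suc n) ⊕ Σ n f                    ≈⟨ +-cong refl (Σ-reverse n f) ⟩
    f (suc n) ⊕ Σ n (λ i → f (n ∸ i))    ≈⟨ Σ-head n _ ⟨
    Σ (suc n) (λ i → f (suc n ∸ i))      ∎

  Σ-triangle : ∀ n (h : ℕ → ℕ → Carrier) →
               Σ n (λ k → Σ k (λ i → h i k)) ≈ Σ n (λ i → Σ (n ∸ i) (λ j → h i (i + j)))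
  Σ-triangle zero    h = refl
  Σ-triangle (suc n) h = begin
    Σ n (λ k → Σ k (λ i → h i k)) ⊕ (Σ n (λ i → h i (suc n)) ⊕ h (suc n) (suc n))
      ≈⟨ +-cong (Σ-triangle n h) refl ⟩
    Σ n (λ i → Σ (n ∸ i) (λ j → h i (i + j))) ⊕ (Σ n (λ i → h i (suc n)) ⊕ h (suc n) (suc n))
      ≈⟨ +-assoc _ _ _ ⟨
    (Σ n (λ i → Σ (n ∸ i) (λ j → h i (i + j))) ⊕ Σ n (λ i → h i (suc n))) ⊕ h (suc n) (suc n)
      ≈⟨ +-cong (Σ-⊕ n _ _) refl ⟨
    Σ n (λ i → Σ (n ∸ i) (λ j → h i (i + j)) ⊕ h i (suc n)) ⊕ h (suc n) (suc n)
      ≈⟨ +-cong (Σ-cong n extend-row) last-row ⟩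
    Σ (suc n) (λ i → Σ (suc n ∸ i) (λ j → h i (i + j)))  ∎
    where
    extend-row : ∀ i → i ≤ n → Σ (n ∸ i) (λ j → h i (i + j)) ⊕ h i (suc n)
                              ≈ Σ (suc n ∸ i) (λ j → h i (i + j))
    extend-row i i≤n rewrite ℕₚ.+-∸-assoc 1 i≤n =
      +-cong refl (reflexive (≡.cong (h i) (≡.sym (≡.trans (ℕₚ.+-suc i (n ∸ i)) (≡.cong suc (ℕₚ.m+[n∸m]≡n i≤n))))))
    last-row : h (suc n) (suc n) ≈ Σ (n ∸ n) (λ j → h (suc n) (suc n + j))
    last-row rewrite ℕₚ.n∸n≡0 n | ℕₚ.+-identityʳ n = refl

  Σ-even : ∀ m g → (∀ j → g (suc (double j)) ≈ 0#) → Σ (double m) g ≈ Σ m (λ j → g (double j))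
  Σ-even zero    g odd≈0 = refl
  Σ-even (suc m) g odd≈0 = +-cong (trans (+-cong (Σ-even m g odd≈0) (odd≈0 m)) (+-identityʳ _)) refl

  R[[X]] : Set c
  R[[X]] = ℕ → Carrier

  infix  4 _≈ₛ_
  infixl 6 _+ₛ_
  infixl 7 _*ₛ_

  _≈ₛ_ : Rel R[[X]] ℓ
  f ≈ₛ g = ∀ n → f n ≈ g n

  _+ₛ_ : R[[X]] → R[[X]] → R[[X]]
  (f +ₛ g) n = f n ⊕ g n

  _*ₛ_ : R[[X]] → R[[X]] → R[[X]]
  (f *ₛ g) n = Σ n (λ i → f i ⊗ g (n ∸ i))

  monomial : ℕ → Carrier → R[[X]]
  monomial k a n = if ⌊ n ≟ k ⌋ then a else 0#

  0ₛ 1ₛ : R[[X]]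
  0ₛ _ = 0#
  1ₛ   = monomial 0 1#

  monomial-at : ∀ k a → monomial k a k ≈ a
  monomial-at k a with k ≟ k
  ... | yes _   = refl
  ... | no k≢k  = contradiction ≡.refl k≢k

  monomial-off : ∀ k a {n} → n ≢ k → monomial k a n ≈ 0#
  monomial-off k a {n} n≢k with n ≟ k
  ... | yes n≡k = contradiction n≡k n≢k
  ... | no _    = refl

  *ₛ-cong : ∀ {f f′ g g′} → f ≈ₛ f′ → g ≈ₛ g′ → f *ₛ g ≈ₛ f′ *ₛ g′
  *ₛ-cong f≈f′ g≈g′ n = Σ-cong n λ i _ → *-cong (f≈f′ i) (g≈g′ (n ∸ i))

  *ₛ-comm : ∀ f g → f *ₛ g ≈ₛ g *ₛ f
  *ₛ-comm f g n = trans (Σ-reverse n _) (Σ-cong n λ i i≤n →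
    trans (*-comm _ _) (*-cong (reflexive (≡.cong g (ℕₚ.m∸[m∸n]≡n i≤n))) refl))

  *ₛ-assoc : ∀ f g h → (f *ₛ g) *ₛ h ≈ₛ f *ₛ (g *ₛ h)
  *ₛ-assoc f g h n = begin
    Σ n (λ k → Σ k (λ i → f i ⊗ g (k ∸ i)) ⊗ h (n ∸ k))
      ≈⟨ Σ-cong n (λ k _ → ⊗-distribʳ-Σ k _ _) ⟩
    Σ n (λ k → Σ k (λ i → (f i ⊗ g (k ∸ i)) ⊗ h (n ∸ k)))
      ≈⟨ Σ-triangle n _ ⟩
    Σ n (λ i → Σ (n ∸ i) (λ j → (f i ⊗ g (i + j ∸ i)) ⊗ h (n ∸ (i + j))))
      ≈⟨ Σ-cong n (λ i _ → trans (Σ-cong (n ∸ i) λ j _ → regroup i j) (sym (⊗-distribˡ-Σ (n ∸ i) _ _))) ⟩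
    Σ n (λ i → f i ⊗ Σ (n ∸ i) (λ j → g j ⊗ h (n ∸ i ∸ j)))  ∎
    where
    regroup : ∀ i j → (f i ⊗ g (i + j ∸ i)) ⊗ h (n ∸ (i + j)) ≈ f i ⊗ (g j ⊗ h (n ∸ i ∸ j))
    regroup i j = trans (*-assoc _ _ _) (*-cong refl (*-cong
      (reflexive (≡.cong g (ℕₚ.m+n∸m≡n i j)))
      (reflexive (≡.cong h (≡.sym (ℕₚ.∸-+-assoc n i j))))))

  *ₛ-identityˡ : ∀ f → 1ₛ *ₛ f ≈ₛ f
  *ₛ-identityˡ f n = begin
    Σ n (λ i → 1ₛ i ⊗ f (n ∸ i))
      ≈⟨ Σ-single n 0 z≤n (λ i _ i≢0 → trans (*-cong (monomial-off 0 1# i≢0) refl) (zeroˡ _)) ⟩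
    1ₛ 0 ⊗ f n
      ≈⟨ trans (*-cong (monomial-at 0 1#) refl) (*-identityˡ _) ⟩
    f n  ∎

  *ₛ-identityʳ : ∀ f → f *ₛ 1ₛ ≈ₛ f
  *ₛ-identityʳ f n = trans (*ₛ-comm f 1ₛ n) (*ₛ-identityˡ f n)

  ≈ₛ-isEquivalence : IsEquivalence _≈ₛ_
  ≈ₛ-isEquivalence = record
    { refl  = λ _ → refl
    ; sym   = λ f≈g n → sym (f≈g n)
    ; trans = λ f≈g g≈h n → trans (f≈g n) (g≈h n)
    }

  commutativeSemiring : CommutativeSemiring c ℓ
  commutativeSemiring = record
    { isCommutativeSemiring = Biased.isCommutativeSemiringˡ record
      { +-isCommutativeMonoid = record
        { isMonoid = record
          { isSemigroup = record
            { isMagma = record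
              { isEquivalence = ≈ₛ-isEquivalence
              ; ∙-cong        = λ f≈f′ g≈g′ n → +-cong (f≈f′ n) (g≈g′ n)
              }
            ; assoc   = λ f g h n → +-assoc (f n) (g n) (h n)
            }
          ; identity = (λ f n → +-identityˡ (f n)) , (λ f n → +-identityʳ (f n))
          }
        ; comm = λ f g n → +-comm (f n) (g n)
        }
      ; *-isCommutativeMonoid = record
        { isMonoid = record
          { isSemigroup = record
            { isMagma = record { isEquivalence = ≈ₛ-isEquivalence ; ∙-cong = *ₛ-cong }
            ; assoc   = *ₛ-assoc
            }
          ; identity = *ₛ-identityˡ , *ₛ-identityʳ
          }
        ; comm = *ₛ-comm
        }
      ; distribʳ = λ h f g n → trans (Σ-cong n λ i _ → distribʳ _ _ _) (Σ-⊕ n _ _)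
      ; zeroˡ    = λ f n → Σ-zero n λ i _ → zeroˡ _
      }
    }

  *ₛ-congUpTo : ∀ n {f f′ g g′} → (∀ i → i ≤ n → f i ≈ f′ i) → (∀ i → i ≤ n → g i ≈ g′ i) →
                (f *ₛ g) n ≈ (f′ *ₛ g′) n
  *ₛ-congUpTo n f≈f′ g≈g′ = Σ-cong n λ i i≤n → *-cong (f≈f′ i i≤n) (g≈g′ (n ∸ i) (ℕₚ.m∸n≤m n i))

  shift : R[[X]] → R[[X]]
  shift f zero    = 0#
  shift f (suc n) = f n

  shift-cong : ∀ {f g} → f ≈ₛ g → shift f ≈ₛ shift g
  shift-cong f≈g zero    = refl
  shift-cong f≈g (suc n) = f≈g n

  shift^ : ℕ → R[[X]] → R[[X]]
  shift^ zero    f = f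
  shift^ (suc k) f = shift (shift^ k f)

  shift^-≥ : ∀ k f {n} → k ≤ n → shift^ k f n ≡ f (n ∸ k)
  shift^-≥ zero    f         _         = ≡.refl
  shift^-≥ (suc k) f {suc n} (s≤s k≤n) = shift^-≥ k f k≤n

  shift^-< : ∀ k f {n} → n < k → shift^ k f n ≡ 0#
  shift^-< (suc k) f {zero}  _         = ≡.refl
  shift^-< (suc k) f {suc n} (s≤s n<k) = shift^-< k f n<k

  monomial-*ₛ : ∀ k a f → monomial k a *ₛ f ≈ₛ (λ n → a ⊗ shift^ k f n)
  monomial-*ₛ k a f n with ℕₚ.≤-<-connex k n
  ... | inj₁ k≤n = begin
    Σ n (λ i → monomial k a i ⊗ f (n ∸ i))
      ≈⟨ Σ-single n k k≤n (λ i _ i≢k → trans (*-cong (monomial-off k a i≢k) refl) (zeroˡ _)) ⟩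
    monomial k a k ⊗ f (n ∸ k)
      ≈⟨ *-cong (monomial-at k a) (reflexive (≡.sym (shift^-≥ k f k≤n))) ⟩
    a ⊗ shift^ k f n  ∎
  ... | inj₂ n<k = begin
    Σ n (λ i → monomial k a i ⊗ f (n ∸ i))
      ≈⟨ Σ-zero n (λ i i≤n → trans (*-cong (monomial-off k a (λ { ≡.refl → ℕₚ.<⇒≱ n<k i≤n })) refl) (zeroˡ _)) ⟩
    0#
      ≈⟨ trans (*-cong refl (reflexive (shift^-< k f n<k))) (zeroʳ a) ⟨
    a ⊗ shift^ k f n  ∎

  -- The substitution X ↦ X².
  dilate : R[[X]] → R[[X]]
  dilate f zero          = f zero
  dilate f (suc zero)    = 0#
  dilate f (suc (suc n)) = dilate (λ m → f (suc m)) n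

  dilate-even : ∀ f m → dilate f (double m) ≡ f m
  dilate-even f zero    = ≡.refl
  dilate-even f (suc m) = dilate-even (λ k → f (suc k)) m

  dilate-odd : ∀ f m → dilate f (suc (double m)) ≡ 0#
  dilate-odd f zero    = ≡.refl
  dilate-odd f (suc m) = dilate-odd (λ k → f (suc k)) m

  dilate-+ₛ : ∀ f g → dilate (f +ₛ g) ≈ₛ dilate f +ₛ dilate g
  dilate-+ₛ f g n with evenOdd n
  ... | even m = reflexive (≡.trans (dilate-even (f +ₛ g) m)
                                    (≡.sym (≡.cong₂ _⊕_ (dilate-even f m) (dilate-even g m))))
  ... | odd m  = trans (reflexive (dilate-odd (f +ₛ g) m))
                       (sym (trans (+-cong (reflexive (dilate-odd f m)) (reflexive (dilate-odd g m)))
                                   (+-identityˡ 0#)))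

  dilate-*ₛ : ∀ f g → dilate (f *ₛ g) ≈ₛ dilate f *ₛ dilate g
  dilate-*ₛ f g n with evenOdd n
  ... | even m = begin
    dilate (f *ₛ g) (double m)
      ≡⟨ dilate-even (f *ₛ g) m ⟩
    Σ m (λ j → f j ⊗ g (m ∸ j))
      ≈⟨ Σ-cong m (λ j _ → *-cong (reflexive (≡.sym (dilate-even f j)))
                                  (reflexive (≡.sym (≡.trans (≡.cong (dilate g) (double-∸ m j))
                                                             (dilate-even g (m ∸ j)))))) ⟩
    Σ m (λ j → dilate f (double j) ⊗ dilate g (double m ∸ double j))
      ≈⟨ Σ-even m _ (λ j → trans (*-cong (reflexive (dilate-odd f j)) refl) (zeroˡ _)) ⟨
    (dilate f *ₛ dilate g) (double m)  ∎
  ... | odd m = trans (reflexive (dilate-odd (f *ₛ g) m)) (sym (Σ-zero (suc (double m)) term≈0))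
    where
    term≈0 : ∀ i → i ≤ suc (double m) → dilate f i ⊗ dilate g (suc (double m) ∸ i) ≈ 0#
    term≈0 i i≤ with evenOdd i
    ... | even j = trans (*-cong refl (reflexive (≡.trans (≡.cong (dilate g) (odd-∸-double (double-≤-odd i≤)))
                                                          (dilate-odd g (m ∸ j)))))
                         (zeroʳ _)
    ... | odd j  = trans (*-cong (reflexive (dilate-odd f j)) refl) (zeroˡ _)

  dilate-monomial : ∀ k a → dilate (monomial k a) ≈ₛ monomial (double k) a
  dilate-monomial k a n with evenOdd n
  ... | odd m  = trans (reflexive (dilate-odd (monomial k a) m))
                       (sym (monomial-off (double k) a (double≢odd k m ∘ ≡.sym)))
  ... | even m = trans (reflexive (dilate-even (monomial k a) m)) (same-value m)
    where
    same-value : ∀ m → monomial k a m ≈ monomial (double k) a (double m)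
    same-value m with m ≟ k
    ... | yes ≡.refl = sym (monomial-at (double m) a)
    ... | no m≢k     = sym (monomial-off (double k) a (m≢k ∘ double-injective))

  shift-shift-dilate : ∀ f → shift (shift (dilate f)) ≈ₛ dilate (shift f)
  shift-shift-dilate f zero          = refl
  shift-shift-dilate f (suc zero)    = refl
  shift-shift-dilate f (suc (suc n)) = refl

  shift-dilate-even : ∀ f m → shift (dilate f) (double m) ≈ 0#
  shift-dilate-even f zero    = refl
  shift-dilate-even f (suc m) = reflexive (dilate-odd f m)

  -- The substitution Y ↦ X, from R[[X]][[Y]] to R[[X]].
  collapse : (ℕ → R[[X]]) → R[[X]]
  collapse F k = Σ k (λ a → F a (k ∸ a))

  collapse-cong : ∀ {F G} → (∀ a → F a ≈ₛ G a) → collapse F ≈ₛ collapse G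
  collapse-cong F≈G k = Σ-cong k λ a _ → F≈G a (k ∸ a)

  collapse-+ₛ : ∀ F G → collapse (λ a → F a +ₛ G a) ≈ₛ collapse F +ₛ collapse G
  collapse-+ₛ F G k = Σ-⊕ k _ _

  collapse-const : ∀ F → (∀ a → F (suc a) ≈ₛ 0ₛ) → collapse F ≈ₛ F 0
  collapse-const F F≈0 k =
    Σ-single k 0 z≤n λ { zero _ 0≢0 → contradiction ≡.refl 0≢0 ; (suc a) _ _ → F≈0 a (k ∸ suc a) }

  collapse-0 : collapse (λ _ → 0ₛ) ≈ₛ 0ₛ
  collapse-0 = collapse-const (λ _ → 0ₛ) (λ _ _ → refl)

  collapse-shiftˣ : ∀ F → collapse (λ a → shift (F a)) ≈ₛ shift (collapse F)
  collapse-shiftˣ F zero    = refl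
  collapse-shiftˣ F (suc k) = trans (+-cong (Σ-cong k λ a a≤k → reflexive (≡.cong (shift (F a)) (ℕₚ.+-∸-assoc 1 a≤k)))
                                            (reflexive (≡.cong (shift (F (suc k))) (ℕₚ.n∸n≡0 k))))
                                    (+-identityʳ _)

  collapse-shiftʸ : ∀ F F′ → F′ 0 ≈ₛ 0ₛ → (∀ a → F′ (suc a) ≈ₛ F a) → collapse F′ ≈ₛ shift (collapse F)
  collapse-shiftʸ F F′ F′0≈0 F′≈F zero    = F′0≈0 0
  collapse-shiftʸ F F′ F′0≈0 F′≈F (suc k) = begin
    collapse F′ (suc k)                              ≈⟨ Σ-head k _ ⟩
    F′ 0 (suc k) ⊕ Σ k (λ a → F′ (suc a) (k ∸ a))    ≈⟨ +-cong (F′0≈0 (suc k)) (Σ-cong k λ a _ → F′≈F a (k ∸ a)) ⟩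
    0# ⊕ collapse F k                                ≈⟨ +-identityˡ _ ⟩
    collapse F k                                     ∎

-- The product ∏ⱼ (1 + x X^(2^j)) (1 + y X^(2^j) + z X^(2·2^j))

module Product {c ℓ} (𝓡 : CommutativeSemiring c ℓ) (x y z : CommutativeSemiring.Carrier 𝓡) where
  open CommutativeSemiring 𝓡 renaming (_+_ to _⊕_; _*_ to _⊗_) hiding (zero)
  open PowerSeries 𝓡
  open CommutativeSemiring commutativeSemiring using ()
    renaming (+-cong to +ₛ-cong; distribʳ to *ₛ-distribʳ-+ₛ; setoid to setoidₛ)
  module ≈-Reasoning  = Relation.Binary.Reasoning.Setoid setoid
  module ≈ₛ-Reasoning = Relation.Binary.Reasoning.Setoid setoidₛ

  factor : ℕ → R[[X]]
  factor j = (1ₛ +ₛ monomial (2 ^ j) x) *ₛ (1ₛ +ₛ (monomial (2 ^ j) y +ₛ monomial (2 * 2 ^ j) z))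

  product : ℕ → R[[X]]
  product zero    = 1ₛ
  product (suc J) = product J *ₛ factor J

  coefficient : ℕ → Carrier
  coefficient n = product (suc n) n

  dilate-factor : ∀ j → dilate (factor j) ≈ₛ factor (suc j)
  dilate-factor j = begin
    dilate (factor j)
      ≈⟨ dilate-*ₛ _ _ ⟩
    dilate (1ₛ +ₛ monomial (2 ^ j) x) *ₛ dilate (1ₛ +ₛ (monomial (2 ^ j) y +ₛ monomial (2 * 2 ^ j) z))
      ≈⟨ *ₛ-cong (≈ₛ-trans (dilate-+ₛ _ _) (+ₛ-cong dilate-1ₛ (dilate-monomial′ _ _)))
                 (≈ₛ-trans (dilate-+ₛ _ _) (+ₛ-cong dilate-1ₛ (≈ₛ-trans (dilate-+ₛ _ _)
                   (+ₛ-cong (dilate-monomial′ _ _) (dilate-monomial′ _ _))))) ⟩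
    factor (suc j)  ∎
    where
    open ≈ₛ-Reasoning
    open IsEquivalence ≈ₛ-isEquivalence using () renaming (trans to ≈ₛ-trans)
    dilate-1ₛ : dilate 1ₛ ≈ₛ 1ₛ
    dilate-1ₛ = dilate-monomial 0 1#
    dilate-monomial′ : ∀ k a → dilate (monomial k a) ≈ₛ monomial (2 * k) a
    dilate-monomial′ k a n = trans (dilate-monomial k a n) (reflexive (≡.cong (λ d → monomial d a n) (double≡2* k)))

  product-suc : ∀ J → product (suc J) ≈ₛ factor 0 *ₛ dilate (product J)
  product-suc zero    n = trans (*ₛ-identityˡ (factor 0) n)
                                (sym (trans (*ₛ-cong {factor 0} (λ _ → refl) (dilate-monomial 0 1#) n)
                                            (*ₛ-identityʳ (factor 0) n)))
  product-suc (suc J) = begin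
    product (suc J) *ₛ factor (suc J)
      ≈⟨ *ₛ-cong {product (suc J)} {g = factor (suc J)} (product-suc J) (λ n → sym (dilate-factor J n)) ⟩
    (factor 0 *ₛ dilate (product J)) *ₛ dilate (factor J)
      ≈⟨ *ₛ-assoc (factor 0) (dilate (product J)) (dilate (factor J)) ⟩
    factor 0 *ₛ (dilate (product J) *ₛ dilate (factor J))
      ≈⟨ *ₛ-cong {factor 0} (λ _ → refl) (λ n → sym (dilate-*ₛ (product J) (factor J) n)) ⟩
    factor 0 *ₛ dilate (product (suc J))  ∎
    where open ≈ₛ-Reasoning

  factor≈1ₛ-below : ∀ j {n} → n < 2 ^ j → factor j n ≈ 1ₛ n
  factor≈1ₛ-below j {n} n<2^j = trans (*ₛ-congUpTo n linear≈1ₛ quadratic≈1ₛ) (*ₛ-identityˡ 1ₛ n)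
    where
    vanishes : ∀ {k a i} → i < k → monomial k a i ≈ 0#
    vanishes i<k = monomial-off _ _ (ℕₚ.<⇒≢ i<k)
    i<2^j : ∀ {i} → i ≤ n → i < 2 ^ j
    i<2^j i≤n = ℕₚ.≤-<-trans i≤n n<2^j
    linear≈1ₛ : ∀ i → i ≤ n → (1ₛ +ₛ monomial (2 ^ j) x) i ≈ 1ₛ i
    linear≈1ₛ i i≤n = trans (+-cong refl (vanishes (i<2^j i≤n))) (+-identityʳ _)
    quadratic≈1ₛ : ∀ i → i ≤ n → (1ₛ +ₛ (monomial (2 ^ j) y +ₛ monomial (2 * 2 ^ j) z)) i ≈ 1ₛ i
    quadratic≈1ₛ i i≤n = trans (+-cong refl (trans (+-cong (vanishes (i<2^j i≤n))
                                                          (vanishes (ℕₚ.<-≤-trans (i<2^j i≤n) (ℕₚ.m≤m+n _ _))))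
                                                   (+-identityʳ 0#)))
                               (+-identityʳ _)

  product-suc-stable : ∀ J {n} → n < 2 ^ J → product (suc J) n ≈ product J n
  product-suc-stable J {n} n<2^J =
    trans (*ₛ-congUpTo n {g′ = 1ₛ} (λ _ _ → refl) (λ i i≤n → factor≈1ₛ-below J (ℕₚ.≤-<-trans i≤n n<2^J)))
          (*ₛ-identityʳ (product J) n)

  product-stable : ∀ {J J′ n} → J ≤′ J′ → n < 2 ^ J → product J′ n ≈ product J n
  product-stable ≤′-refl                   _     = refl
  product-stable {J} {suc J′} (≤′-step J≤′J′) n<2^J =
    trans (product-suc-stable J′ (ℕₚ.<-≤-trans n<2^J (ℕₚ.^-monoʳ-≤ 2 (ℕₚ.≤′⇒≤ J≤′J′)))) (product-stable J≤′J′ n<2^J)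

  product≈coefficient : ∀ {J n} → n ≤ J → product J n ≈ coefficient n
  product≈coefficient {J} {n} n≤J =
    trans (product-stable (ℕₚ.≤⇒≤′ n≤J) (n<2^n n)) (sym (product-suc-stable n (n<2^n n)))

  private
    yz-part : R[[X]] → R[[X]]
    yz-part f = (1ₛ +ₛ (monomial 1 y +ₛ monomial 2 z)) *ₛ dilate f

    yz-part-coeff : ∀ f n → yz-part f n ≈ dilate f n ⊕ (y ⊗ shift (dilate f) n ⊕ z ⊗ dilate (shift f) n)
    yz-part-coeff f n =
      trans (*ₛ-distribʳ-+ₛ (dilate f) 1ₛ _ n)
            (+-cong (*ₛ-identityˡ (dilate f) n)
                    (trans (*ₛ-distribʳ-+ₛ (dilate f) (monomial 1 y) (monomial 2 z) n)
                           (+-cong (monomial-*ₛ 1 y (dilate f) n)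
                                   (trans (monomial-*ₛ 2 z (dilate f) n) (*-cong refl (shift-shift-dilate f n))))))

    yz-part-even : ∀ f m → yz-part f (double m) ≈ f m ⊕ z ⊗ shift f m
    yz-part-even f m = begin
      yz-part f (double m)
        ≈⟨ yz-part-coeff f (double m) ⟩
      dilate f (double m) ⊕ (y ⊗ shift (dilate f) (double m) ⊕ z ⊗ dilate (shift f) (double m))
        ≈⟨ +-cong (reflexive (dilate-even f m))
                  (+-cong (*-cong refl (shift-dilate-even f m))
                          (*-cong refl (reflexive (dilate-even (shift f) m)))) ⟩
      f m ⊕ (y ⊗ 0# ⊕ z ⊗ shift f m)
        ≈⟨ +-cong refl (trans (+-cong (zeroʳ y) refl) (+-identityˡ _)) ⟩
      f m ⊕ z ⊗ shift f m  ∎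
      where open ≈-Reasoning

    yz-part-odd : ∀ f m → yz-part f (suc (double m)) ≈ y ⊗ f m
    yz-part-odd f m = begin
      yz-part f (suc (double m))
        ≈⟨ yz-part-coeff f (suc (double m)) ⟩
      dilate f (suc (double m)) ⊕ (y ⊗ dilate f (double m) ⊕ z ⊗ dilate (shift f) (suc (double m)))
        ≈⟨ +-cong (reflexive (dilate-odd f m))
                  (+-cong (*-cong refl (reflexive (dilate-even f m)))
                          (*-cong refl (reflexive (dilate-odd (shift f) m)))) ⟩
      0# ⊕ (y ⊗ f m ⊕ z ⊗ 0#)
        ≈⟨ trans (+-identityˡ _) (trans (+-cong refl (zeroʳ z)) (+-identityʳ _)) ⟩
      y ⊗ f m  ∎
      where open ≈-Reasoning

    factor₀-*ₛ-dilate : ∀ f n → (factor 0 *ₛ dilate f) n ≈ yz-part f n ⊕ x ⊗ shift (yz-part f) n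
    factor₀-*ₛ-dilate f n =
      trans (*ₛ-assoc (1ₛ +ₛ monomial 1 x) _ (dilate f) n)
            (trans (*ₛ-distribʳ-+ₛ (yz-part f) 1ₛ (monomial 1 x) n)
                   (+-cong (*ₛ-identityˡ (yz-part f) n) (monomial-*ₛ 1 x (yz-part f) n)))

  factor₀-*ₛ-dilate-even : ∀ f m → (factor 0 *ₛ dilate f) (double m) ≈ f m ⊕ z ⊗ shift f m ⊕ x ⊗ (y ⊗ shift f m)
  factor₀-*ₛ-dilate-even f m =
    trans (factor₀-*ₛ-dilate f (double m)) (+-cong (yz-part-even f m) (*-cong refl (shifted m)))
    where
    shifted : ∀ m → shift (yz-part f) (double m) ≈ y ⊗ shift f m
    shifted zero    = sym (zeroʳ y)
    shifted (suc m) = yz-part-odd f m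

  factor₀-*ₛ-dilate-odd : ∀ f m → (factor 0 *ₛ dilate f) (suc (double m)) ≈ y ⊗ f m ⊕ x ⊗ (f m ⊕ z ⊗ shift f m)
  factor₀-*ₛ-dilate-odd f m =
    trans (factor₀-*ₛ-dilate f (suc (double m))) (+-cong (yz-part-odd f m) (*-cong refl (yz-part-even f m)))

  private
    shift-product≈shift-coefficient : ∀ {J m} → m ≤ J → shift (product J) m ≈ shift coefficient m
    shift-product≈shift-coefficient {m = zero}  _   = refl
    shift-product≈shift-coefficient {m = suc m} m≤J = product≈coefficient (ℕₚ.<⇒≤ m≤J)

  coefficient-even : ∀ m → coefficient (double m) ≈
                           coefficient m ⊕ z ⊗ shift coefficient m ⊕ x ⊗ (y ⊗ shift coefficient m)
  coefficient-even m = begin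
    product (suc (double m)) (double m)
      ≈⟨ product-suc (double m) (double m) ⟩
    (factor 0 *ₛ dilate (product (double m))) (double m)
      ≈⟨ factor₀-*ₛ-dilate-even (product (double m)) m ⟩
    product (double m) m ⊕ z ⊗ shift (product (double m)) m ⊕ x ⊗ (y ⊗ shift (product (double m)) m)
      ≈⟨ +-cong (+-cong (product≈coefficient m≤2m) (*-cong refl shifts-agree))
                (*-cong refl (*-cong refl shifts-agree)) ⟩
    coefficient m ⊕ z ⊗ shift coefficient m ⊕ x ⊗ (y ⊗ shift coefficient m)  ∎
    where
    open ≈-Reasoning
    m≤2m : m ≤ double m
    m≤2m = n≤double m
    shifts-agree : shift (product (double m)) m ≈ shift coefficient m
    shifts-agree = shift-product≈shift-coefficient m≤2m

  coefficient-odd : ∀ m → coefficient (suc (double m)) ≈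
                          y ⊗ coefficient m ⊕ x ⊗ (coefficient m ⊕ z ⊗ shift coefficient m)
  coefficient-odd m = begin
    product (suc (suc (double m))) (suc (double m))
      ≈⟨ product-suc (suc (double m)) (suc (double m)) ⟩
    (factor 0 *ₛ dilate (product (suc (double m)))) (suc (double m))
      ≈⟨ factor₀-*ₛ-dilate-odd (product (suc (double m))) m ⟩
    y ⊗ product (suc (double m)) m ⊕ x ⊗ (product (suc (double m)) m ⊕ z ⊗ shift (product (suc (double m))) m)
      ≈⟨ +-cong (*-cong refl agrees)
                (*-cong refl (+-cong agrees (*-cong refl (shift-product≈shift-coefficient m≤2m+1)))) ⟩
    y ⊗ coefficient m ⊕ x ⊗ (coefficient m ⊕ z ⊗ shift coefficient m)  ∎
    where
    open ≈-Reasoning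
    m≤2m+1 : m ≤ suc (double m)
    m≤2m+1 = ℕₚ.m≤n⇒m≤1+n (n≤double m)
    agrees : product (suc (double m)) m ≈ coefficient m
    agrees = product≈coefficient m≤2m+1

  coefficient-zero : coefficient 0 ≈ 1#
  coefficient-zero = trans (product-suc-stable 0 (s≤s z≤n)) (monomial-at 0 1#)

module Iterated {c ℓ} (𝓡 : CommutativeSemiring c ℓ) where
  open CommutativeSemiring 𝓡 using () renaming (_+_ to _⊕_)
  open PowerSeries 𝓡 using (Σ; commutativeSemiring)
  module R[[X]][[Y]] = PowerSeries commutativeSemiring

  Σ-pointwise : ∀ n F k → R[[X]][[Y]].Σ n F k ≡ Σ n (λ i → F i k)
  Σ-pointwise zero    F k = ≡.refl
  Σ-pointwise (suc n) F k = ≡.cong (_⊕ F (suc n) k) (Σ-pointwise n F k)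

-- Specialisation to ℕ[x,y,z] and to x = y = z

open import Defs

-- Poly3 is the iterated power series ring ℕ[[z]][[y]][[x]], written ℕ[x,y,z] below since only
-- polynomials occur, with P a b c the coefficient of x^a y^b z^c; Series is Poly3[[q]].
module ℕ[z]     = PowerSeries ℕₚ.+-*-commutativeSemiring
module ℕ[y,z]   = PowerSeries ℕ[z].commutativeSemiring
module ℕ[x,y,z] = PowerSeries ℕ[y,z].commutativeSemiring
module ℕ[x,y,z][[q]] = PowerSeries ℕ[x,y,z].commutativeSemiring

module Z   = CommutativeSemiring ℕ[z].commutativeSemiring
module YZ  = CommutativeSemiring ℕ[y,z].commutativeSemiring
module XYZ = CommutativeSemiring ℕ[x,y,z].commutativeSemiring
open XYZ using () renaming (_+_ to _⊕_; _*_ to _⊗_)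
module XYZ[[q]] = CommutativeSemiring ℕ[x,y,z][[q]].commutativeSemiring

xyz-monomial : ℕ → ℕ → ℕ → Poly3
xyz-monomial a b c = ℕ[x,y,z].monomial a (ℕ[y,z].monomial b (ℕ[z].monomial c 1))

x y z : Poly3
x = xyz-monomial 1 0 0
y = xyz-monomial 0 1 0
z = xyz-monomial 0 0 1

open Iterated ℕₚ.+-*-commutativeSemiring using () renaming (Σ-pointwise to Σ-pointwise₁)
open Iterated ℕ[z].commutativeSemiring     using () renaming (Σ-pointwise to Σ-pointwise₂)
open Iterated ℕ[y,z].commutativeSemiring   using () renaming (Σ-pointwise to Σ-pointwise₃)

sumTo≡Σ : ∀ n f → sumTo n f ≡ ℕ[z].Σ n f
sumTo≡Σ zero    f = ≡.refl
sumTo≡Σ (suc n) f = ≡.cong (_+ f (suc n)) (sumTo≡Σ n f)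

*P-pointwise : ∀ P P′ a b c → (P *P P′) a b c ≡ (P ℕ[x,y,z].*ₛ P′) a b c
*P-pointwise P P′ a b c = begin
  sumTo a (λ i → sumTo b (λ j → sumTo c (λ k → P i j k * P′ (a ∸ i) (b ∸ j) (c ∸ k))))
    ≡⟨ ≡.trans (sumTo≡Σ a _) (ℕ[z].Σ-cong a λ i _ → ≡.trans (sumTo≡Σ b _) (ℕ[z].Σ-cong b λ j _ → sumTo≡Σ c _)) ⟩
  ℕ[z].Σ a (λ i → ℕ[z].Σ b (λ j → (P i j ℕ[z].*ₛ P′ (a ∸ i) (b ∸ j)) c))
    ≡⟨ ℕ[z].Σ-cong a (λ i _ → ≡.sym (Σ-pointwise₁ b _ c)) ⟩
  ℕ[z].Σ a (λ i → (P i ℕ[y,z].*ₛ P′ (a ∸ i)) b c)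
    ≡⟨ ≡.sym (≡.trans (≡.cong-app (Σ-pointwise₂ a _ b) c) (Σ-pointwise₁ a _ c)) ⟩
  (P ℕ[x,y,z].*ₛ P′) a b c  ∎
  where open ≡.≡-Reasoning

sumP-pointwise : ∀ n F a b c → sumP n F a b c ≡ sumTo n (λ m → F m a b c)
sumP-pointwise zero    F a b c = ≡.refl
sumP-pointwise (suc n) F a b c = ≡.cong (_+ F (suc n) a b c) (sumP-pointwise n F a b c)

*S-pointwise : ∀ S T n a b c → (S *S T) n a b c ≡ (S ℕ[x,y,z][[q]].*ₛ T) n a b c
*S-pointwise S T n a b c = begin
  sumP n (λ m → S m *P T (n ∸ m)) a b c
    ≡⟨ ≡.trans (sumP-pointwise n _ a b c) (sumTo≡Σ n _) ⟩
  ℕ[z].Σ n (λ m → (S m *P T (n ∸ m)) a b c)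
    ≡⟨ ℕ[z].Σ-cong n (λ m _ → *P-pointwise (S m) (T (n ∸ m)) a b c) ⟩
  ℕ[z].Σ n (λ m → (S m ℕ[x,y,z].*ₛ T (n ∸ m)) a b c)
    ≡⟨ ≡.sym (≡.trans (≡.cong-app (≡.cong-app (Σ-pointwise₃ n _ a) b) c)
                      (≡.trans (≡.cong-app (Σ-pointwise₂ n _ b) c) (Σ-pointwise₁ n _ c))) ⟩
  (S ℕ[x,y,z][[q]].*ₛ T) n a b c  ∎
  where open ≡.≡-Reasoning

monoS≈monomial : ∀ a b c e → monoS a b c e XYZ[[q]].≈ ℕ[x,y,z][[q]].monomial e (xyz-monomial a b c)
monoS≈monomial a b c e n a′ b′ c′ with n ≟ e
... | no _ = ≡.refl
... | yes _ with a′ ≟ a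
...   | no _ = ≡.refl
...   | yes _ with b′ ≟ b
...     | no _ = ≡.refl
...     | yes _ with c′ ≟ c
...       | no _  = ≡.refl
...       | yes _ = ≡.refl

module GF = Product ℕ[x,y,z].commutativeSemiring x y z

factor≈ : ∀ j → factor j XYZ[[q]].≈ GF.factor j
factor≈ j n = XYZ.trans (*S-pointwise linear quadratic n)
  (XYZ[[q]].*-cong {linear} {u = quadratic}
     (XYZ[[q]].+-cong {oneS} (monoS≈monomial 0 0 0 0) (monoS≈monomial 1 0 0 (2 ^ j)))
     (XYZ[[q]].+-cong {oneS} (monoS≈monomial 0 0 0 0)
        (XYZ[[q]].+-cong {monoS 0 1 0 (2 ^ j)} (monoS≈monomial 0 1 0 (2 ^ j)) (monoS≈monomial 0 0 1 (2 * 2 ^ j)))) n)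
  where
  linear quadratic : Series
  linear    = oneS +S monoS 1 0 0 (2 ^ j)
  quadratic = oneS +S (monoS 0 1 0 (2 ^ j) +S monoS 0 0 1 (2 * 2 ^ j))

prodTo≈product : ∀ J → prodTo J XYZ[[q]].≈ GF.product J
prodTo≈product zero      = monoS≈monomial 0 0 0 0
prodTo≈product (suc J) n = XYZ.trans (*S-pointwise (prodTo J) (factor J) n)
                                     (XYZ[[q]].*-cong {prodTo J} {u = factor J} (prodTo≈product J) (factor≈ J) n)

p≈coefficient : ∀ n → p n XYZ.≈ GF.coefficient n
p≈coefficient n = prodTo≈product (suc n) n

open ℕ[z] using (_+ₛ_; 1ₛ; shift; collapse)

diagonal : Poly3 → (ℕ → ℕ)
diagonal P = collapse (λ a → collapse (P a))

diag≗diagonal : ∀ P → diag P ≗ diagonal P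
diag≗diagonal P k = ≡.trans (sumTo≡Σ k _) (ℕ[z].Σ-cong k λ a _ → sumTo≡Σ (k ∸ a) _)

diagonal-cong : ∀ {P P′} → P XYZ.≈ P′ → diagonal P ≗ diagonal P′
diagonal-cong P≈P′ = ℕ[z].collapse-cong λ a → ℕ[z].collapse-cong (P≈P′ a)

diagonal-⊕ : ∀ P P′ → diagonal (P ⊕ P′) ≗ diagonal P +ₛ diagonal P′
diagonal-⊕ P P′ k = ≡.trans (ℕ[z].collapse-cong (λ a → ℕ[z].collapse-+ₛ (P a) (P′ a)) k)
                            (ℕ[z].collapse-+ₛ (λ a → collapse (P a)) (λ a → collapse (P′ a)) k)

diagonal-1 : diagonal XYZ.1# ≗ 1ₛ
diagonal-1 k = ≡.trans (ℕ[z].collapse-const (λ a → collapse (XYZ.1# a)) (λ _ → ℕ[z].collapse-0) k)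
                       (ℕ[z].collapse-const (XYZ.1# 0) (λ _ _ → ≡.refl) k)

x⊗≈shift : ∀ P → x ⊗ P XYZ.≈ ℕ[x,y,z].shift P
x⊗≈shift P a = YZ.trans (ℕ[x,y,z].monomial-*ₛ 1 YZ.1# P a) (YZ.*-identityˡ (ℕ[x,y,z].shift P a))

y⊗≈shift : ∀ P → y ⊗ P XYZ.≈ (λ a → ℕ[y,z].shift (P a))
y⊗≈shift P a b = Z.trans (ℕ[x,y,z].monomial-*ₛ 0 _ P a b)
                         (Z.trans (ℕ[y,z].monomial-*ₛ 1 Z.1# (P a) b) (Z.*-identityˡ (ℕ[y,z].shift (P a) b)))

z⊗≈shift : ∀ P → z ⊗ P XYZ.≈ (λ a b → shift (P a b))
z⊗≈shift P a b c = ≡.trans (ℕ[x,y,z].monomial-*ₛ 0 _ P a b c)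
                           (≡.trans (ℕ[y,z].monomial-*ₛ 0 _ (P a) b c)
                                    (≡.trans (ℕ[z].monomial-*ₛ 1 1 (P a b) c) (ℕₚ.*-identityˡ _)))

diagonal-x⊗ : ∀ P → diagonal (x ⊗ P) ≗ shift (diagonal P)
diagonal-x⊗ P k = ≡.trans (diagonal-cong (x⊗≈shift P) k)
  (ℕ[z].collapse-shiftʸ (λ a → collapse (P a)) (λ a → collapse (ℕ[x,y,z].shift P a))
                        ℕ[z].collapse-0 (λ _ _ → ≡.refl) k)

diagonal-y⊗ : ∀ P → diagonal (y ⊗ P) ≗ shift (diagonal P)
diagonal-y⊗ P k = ≡.trans (diagonal-cong (y⊗≈shift P) k)
  (≡.trans (ℕ[z].collapse-cong (λ a → ℕ[z].collapse-shiftʸ (P a) (ℕ[y,z].shift (P a)) (λ _ → ≡.refl) (λ _ _ → ≡.refl))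
                                k)
           (ℕ[z].collapse-shiftˣ (λ a → collapse (P a)) k))

diagonal-z⊗ : ∀ P → diagonal (z ⊗ P) ≗ shift (diagonal P)
diagonal-z⊗ P k = ≡.trans (diagonal-cong (z⊗≈shift P) k)
  (≡.trans (ℕ[z].collapse-cong (λ a → ℕ[z].collapse-shiftˣ (P a)) k)
           (ℕ[z].collapse-shiftˣ (λ a → collapse (P a)) k))

open GF using (coefficient)

p-diagonal : ℕ → (ℕ → ℕ)
p-diagonal n = diagonal (coefficient n)

diag-p : ∀ n → diag (p n) ≗ p-diagonal n
diag-p n k = ≡.trans (diag≗diagonal (p n) k) (diagonal-cong (p≈coefficient n) k)

p-diagonal-zero : p-diagonal 0 ≗ 1ₛ
p-diagonal-zero k = ≡.trans (diagonal-cong GF.coefficient-zero k) (diagonal-1 k)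

p-diagonal-one : p-diagonal 1 ≗ shift (p-diagonal 0) +ₛ shift (p-diagonal 0)
p-diagonal-one k = begin
  diagonal (coefficient 1) k
    ≡⟨ diagonal-cong (XYZ.trans (GF.coefficient-odd 0)
                                (XYZ.+-cong {y ⊗ p₀} XYZ.refl (XYZ.*-cong {x} XYZ.refl p₀⊕z⊗0≈p₀))) k ⟩
  diagonal (y ⊗ p₀ ⊕ x ⊗ p₀) k
    ≡⟨ diagonal-⊕ (y ⊗ p₀) (x ⊗ p₀) k ⟩
  diagonal (y ⊗ p₀) k + diagonal (x ⊗ p₀) k
    ≡⟨ ≡.cong₂ _+_ (diagonal-y⊗ p₀ k) (diagonal-x⊗ p₀ k) ⟩
  shift (p-diagonal 0) k + shift (p-diagonal 0) k  ∎
  where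
  open ≡.≡-Reasoning
  p₀ : Poly3
  p₀ = coefficient 0
  p₀⊕z⊗0≈p₀ : p₀ ⊕ z ⊗ XYZ.0# XYZ.≈ p₀
  p₀⊕z⊗0≈p₀ = XYZ.trans (XYZ.+-cong {p₀} XYZ.refl (XYZ.zeroʳ z)) (XYZ.+-identityʳ p₀)

p-diagonal-even : ∀ m → p-diagonal (double (suc m)) ≗
                        p-diagonal (suc m) +ₛ shift (p-diagonal m) +ₛ shift (shift (p-diagonal m))
p-diagonal-even m k = begin
  diagonal (coefficient (double (suc m))) k
    ≡⟨ diagonal-cong (GF.coefficient-even (suc m)) k ⟩
  diagonal (pₘ₊₁ ⊕ z ⊗ pₘ ⊕ x ⊗ (y ⊗ pₘ)) k
    ≡⟨ ≡.trans (diagonal-⊕ (pₘ₊₁ ⊕ z ⊗ pₘ) (x ⊗ (y ⊗ pₘ)) k)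
               (≡.cong (_+ diagonal (x ⊗ (y ⊗ pₘ)) k) (diagonal-⊕ pₘ₊₁ (z ⊗ pₘ) k)) ⟩
  diagonal pₘ₊₁ k + diagonal (z ⊗ pₘ) k + diagonal (x ⊗ (y ⊗ pₘ)) k
    ≡⟨ ≡.cong₂ _+_ (≡.cong (diagonal pₘ₊₁ k +_) (diagonal-z⊗ pₘ k))
                   (≡.trans (diagonal-x⊗ (y ⊗ pₘ) k) (ℕ[z].shift-cong (diagonal-y⊗ pₘ) k)) ⟩
  p-diagonal (suc m) k + shift (p-diagonal m) k + shift (shift (p-diagonal m)) k  ∎
  where
  open ≡.≡-Reasoning
  pₘ pₘ₊₁ : Poly3
  pₘ   = coefficient m
  pₘ₊₁ = coefficient (suc m)

p-diagonal-odd : ∀ m → p-diagonal (suc (double (suc m))) ≗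
                       shift (p-diagonal (suc m)) +ₛ shift (p-diagonal (suc m) +ₛ shift (p-diagonal m))
p-diagonal-odd m k = begin
  diagonal (coefficient (suc (double (suc m)))) k
    ≡⟨ diagonal-cong (GF.coefficient-odd (suc m)) k ⟩
  diagonal (y ⊗ pₘ₊₁ ⊕ x ⊗ (pₘ₊₁ ⊕ z ⊗ pₘ)) k
    ≡⟨ diagonal-⊕ (y ⊗ pₘ₊₁) (x ⊗ (pₘ₊₁ ⊕ z ⊗ pₘ)) k ⟩
  diagonal (y ⊗ pₘ₊₁) k + diagonal (x ⊗ (pₘ₊₁ ⊕ z ⊗ pₘ)) k
    ≡⟨ ≡.cong₂ _+_ (diagonal-y⊗ pₘ₊₁ k) (≡.trans (diagonal-x⊗ (pₘ₊₁ ⊕ z ⊗ pₘ) k) (ℕ[z].shift-cong inner k)) ⟩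
  shift (p-diagonal (suc m)) k + shift (p-diagonal (suc m) +ₛ shift (p-diagonal m)) k  ∎
  where
  open ≡.≡-Reasoning
  pₘ pₘ₊₁ : Poly3
  pₘ   = coefficient m
  pₘ₊₁ = coefficient (suc m)
  inner : diagonal (pₘ₊₁ ⊕ z ⊗ pₘ) ≗ p-diagonal (suc m) +ₛ shift (p-diagonal m)
  inner j = ≡.trans (diagonal-⊕ pₘ₊₁ (z ⊗ pₘ) j) (≡.cong (diagonal pₘ₊₁ j +_) (diagonal-z⊗ pₘ j))

2^suc≡ : ∀ n → 2 ^ suc n ≡ suc (suc (double (2 ^ n ∸ 1)))
2^suc≡ n = ≡.trans (≡.sym (double≡2* (2 ^ n))) (≡.cong double (≡.sym (ℕₚ.suc-pred (2 ^ n) {{ℕₚ.m^n≢0 2 n}})))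

Q≗p-diagonal : ∀ n → Q n ≗ p-diagonal (double (2 ^ n ∸ 1))
Q≗p-diagonal n k = ≡.trans (≡.cong (λ i → diag (p (i ∸ 2)) k) (2^suc≡ n)) (diag-p (double (2 ^ n ∸ 1)) k)

R≗p-diagonal : ∀ n → R (suc n) ≗ p-diagonal (suc (double (2 ^ n ∸ 1)))
R≗p-diagonal n k = ≡.trans (≡.cong (λ i → diag (p (i ∸ 1)) k) (2^suc≡ n)) (diag-p (suc (double (2 ^ n ∸ 1))) k)

Q-zero : Q 0 ≗ 1ₛ
Q-zero k = ≡.trans (diag-p 0 k) (p-diagonal-zero k)

R-one : R 1 ≗ shift (Q 0) +ₛ shift (Q 0)
R-one k = ≡.trans (diag-p 1 k) (≡.trans (p-diagonal-one k) (≡.sym (≡.cong₂ _+_ Q₀-shift Q₀-shift)))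
  where
  Q₀-shift : shift (Q 0) k ≡ shift (p-diagonal 0) k
  Q₀-shift = ℕ[z].shift-cong (diag-p 0) k

Q-suc : ∀ n → Q (suc n) ≗ R (suc n) +ₛ shift (Q n) +ₛ shift (shift (Q n))
Q-suc n k = begin
  Q (suc n) k
    ≡⟨ Q≗p-diagonal (suc n) k ⟩
  p-diagonal (double (2 ^ suc n ∸ 1)) k
    ≡⟨ ≡.cong (λ i → p-diagonal (double (i ∸ 1)) k) (2^suc≡ n) ⟩
  p-diagonal (double (suc h)) k
    ≡⟨ p-diagonal-even h k ⟩
  p-diagonal (suc h) k + shift (p-diagonal h) k + shift (shift (p-diagonal h)) k
    ≡⟨ ≡.sym (≡.cong₂ _+_ (≡.cong₂ _+_ (R≗p-diagonal n k) (ℕ[z].shift-cong (Q≗p-diagonal n) k))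
                          (ℕ[z].shift-cong (ℕ[z].shift-cong (Q≗p-diagonal n)) k)) ⟩
  R (suc n) k + shift (Q n) k + shift (shift (Q n)) k  ∎
  where
  open ≡.≡-Reasoning
  h : ℕ
  h = double (2 ^ n ∸ 1)

R-suc : ∀ n → R (suc (suc n)) ≗ shift (R (suc n)) +ₛ shift (R (suc n) +ₛ shift (Q n))
R-suc n k = begin
  R (suc (suc n)) k
    ≡⟨ R≗p-diagonal (suc n) k ⟩
  p-diagonal (suc (double (2 ^ suc n ∸ 1))) k
    ≡⟨ ≡.cong (λ i → p-diagonal (suc (double (i ∸ 1))) k) (2^suc≡ n) ⟩
  p-diagonal (suc (double (suc h))) k
    ≡⟨ p-diagonal-odd h k ⟩
  shift (p-diagonal (suc h)) k + shift (p-diagonal (suc h) +ₛ shift (p-diagonal h)) k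
    ≡⟨ ≡.sym (≡.cong₂ _+_ (ℕ[z].shift-cong R≗ k)
                          (ℕ[z].shift-cong (λ j → ≡.cong₂ _+_ (R≗ j) (ℕ[z].shift-cong (Q≗p-diagonal n) j)) k)) ⟩
  shift (R (suc n)) k + shift (R (suc n) +ₛ shift (Q n)) k  ∎
  where
  open ≡.≡-Reasoning
  h : ℕ
  h = double (2 ^ n ∸ 1)
  R≗ : R (suc n) ≗ p-diagonal (suc h)
  R≗ = R≗p-diagonal n

-- Coefficients of Q and R

record SupportedIn (f : ℕ → ℕ) (a b : ℕ) : Set where
  field
    below : ∀ k → k < a → f k ≡ 0
    above : ∀ k → b < k → f k ≡ 0
open SupportedIn

supportedIn-≗ : ∀ {f g a b} → f ≗ g → SupportedIn g a b → SupportedIn f a b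
supportedIn-≗ f≗g g∈ = record { below = λ k k<a → ≡.trans (f≗g k) (below g∈ k k<a)
                              ; above = λ k b<k → ≡.trans (f≗g k) (above g∈ k b<k) }

supportedIn-weaken : ∀ {f a a′ b b′} → a′ ≤ a → b ≤ b′ → SupportedIn f a b → SupportedIn f a′ b′
supportedIn-weaken a′≤a b≤b′ f∈ = record { below = λ k k<a′ → below f∈ k (ℕₚ.<-≤-trans k<a′ a′≤a)
                                          ; above = λ k b′<k → above f∈ k (ℕₚ.≤-<-trans b≤b′ b′<k) }

supportedIn-shift : ∀ {f a b} → SupportedIn f a b → SupportedIn (shift f) (suc a) (suc b)
supportedIn-shift f∈ = record { below = λ { zero _ → ≡.refl ; (suc k) (s≤s k<a) → below f∈ k k<a }
                              ; above = λ { (suc k) (s≤s b<k) → above f∈ k b<k } }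

supportedIn-+ : ∀ {f g a b} → SupportedIn f a b → SupportedIn g a b → SupportedIn (f +ₛ g) a b
supportedIn-+ f∈ g∈ = record { below = λ k k<a → ≡.cong₂ _+_ (below f∈ k k<a) (below g∈ k k<a)
                             ; above = λ k b<k → ≡.cong₂ _+_ (above f∈ k b<k) (above g∈ k b<k) }

Q-support-step : ∀ {n} → SupportedIn (Q n) n (double n) → SupportedIn (R (suc n)) (suc n) (suc (double n)) →
                 SupportedIn (Q (suc n)) (suc n) (double (suc n))
Q-support-step {n} Q∈ R∈ = supportedIn-≗ (Q-suc n)
  (supportedIn-+ (supportedIn-+ (supportedIn-weaken ℕₚ.≤-refl (ℕₚ.n≤1+n _) R∈)
                                (supportedIn-weaken ℕₚ.≤-refl (ℕₚ.n≤1+n _) (supportedIn-shift Q∈)))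
                 (supportedIn-weaken (ℕₚ.n≤1+n _) ℕₚ.≤-refl (supportedIn-shift (supportedIn-shift Q∈))))

R-support-step : ∀ {n} → SupportedIn (Q n) n (double n) → SupportedIn (R (suc n)) (suc n) (suc (double n)) →
                 SupportedIn (R (suc (suc n))) (suc (suc n)) (double (suc n))
R-support-step {n} Q∈ R∈ = supportedIn-≗ (R-suc n)
  (supportedIn-+ (supportedIn-shift R∈) (supportedIn-shift (supportedIn-+ R∈ (supportedIn-shift Q∈))))

support : ∀ n → SupportedIn (Q n) n (double n) × SupportedIn (R (suc n)) (suc n) (suc (double n))
support zero    = Q₀∈ , supportedIn-≗ R-one (supportedIn-+ (supportedIn-shift Q₀∈) (supportedIn-shift Q₀∈))
  where
  Q₀∈ : SupportedIn (Q 0) 0 0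
  Q₀∈ = record { below = λ _ () ; above = λ { (suc k) _ → Q-zero (suc k) } }
support (suc n) = Q-support-step Qₙ∈ Rₙ₊₁∈ , supportedIn-weaken ℕₚ.≤-refl (ℕₚ.n≤1+n _) (R-support-step Qₙ∈ Rₙ₊₁∈)
  where
  Qₙ∈ : SupportedIn (Q n) n (double n)
  Qₙ∈ = proj₁ (support n)
  Rₙ₊₁∈ : SupportedIn (R (suc n)) (suc n) (suc (double n))
  Rₙ₊₁∈ = proj₂ (support n)

Q-supportedIn : ∀ n → SupportedIn (Q n) n (double n)
Q-supportedIn n = proj₁ (support n)

R-supportedIn : ∀ n → SupportedIn (R (suc n)) (suc n) (suc (double n))
R-supportedIn n = proj₂ (support n)

R-supportedIn-tight : ∀ n → SupportedIn (R (suc (suc n))) (suc (suc n)) (double (suc n))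
R-supportedIn-tight n = R-support-step (Q-supportedIn n) (R-supportedIn n)

Q-top : ∀ n → Q n (double n) ≡ 1
Q-top zero    = Q-zero 0
Q-top (suc n) = begin
  Q (suc n) (suc (suc (double n)))
    ≡⟨ Q-suc n (suc (suc (double n))) ⟩
  R (suc n) (suc (suc (double n))) + Q n (suc (double n)) + Q n (double n)
    ≡⟨ ≡.cong₂ _+_ (≡.cong₂ _+_ (above (R-supportedIn n) _ ℕₚ.≤-refl) (above (Q-supportedIn n) _ ℕₚ.≤-refl))
                   (Q-top n) ⟩
  1  ∎
  where open ≡.≡-Reasoning

R-top : ∀ n → R (suc (suc (suc n))) (double (suc (suc n))) ≡ 1
R-top n = begin
  R (suc (suc (suc n))) (suc (suc (double (suc n))))
    ≡⟨ R-suc (suc n) (suc (suc (double (suc n)))) ⟩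
  R (suc (suc n)) (suc (double (suc n)))
    + (R (suc (suc n)) (suc (double (suc n))) + Q (suc n) (double (suc n)))
    ≡⟨ ≡.cong₂ _+_ R-vanishes (≡.cong₂ _+_ R-vanishes (Q-top (suc n))) ⟩
  1  ∎
  where
  open ≡.≡-Reasoning
  R-vanishes : R (suc (suc n)) (suc (double (suc n))) ≡ 0
  R-vanishes = above (R-supportedIn-tight n) _ ℕₚ.≤-refl

Q-subtop : ∀ n → Q (suc n) (suc (double n)) ≡ suc n + 2
Q-subtop zero    = begin
  Q 1 1                       ≡⟨ Q-suc 0 1 ⟩
  R 1 1 + Q 0 0 + 0           ≡⟨ ≡.cong (λ r → r + Q 0 0 + 0) (R-one 1) ⟩
  Q 0 0 + Q 0 0 + Q 0 0 + 0   ≡⟨ ≡.cong (λ q → q + q + q + 0) (Q-zero 0) ⟩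
  3                           ∎
  where open ≡.≡-Reasoning
Q-subtop (suc n) = begin
  Q (suc (suc n)) (suc (double (suc n)))
    ≡⟨ Q-suc (suc n) (suc (double (suc n))) ⟩
  R (suc (suc n)) (suc (double (suc n))) + Q (suc n) (double (suc n)) + Q (suc n) (suc (double n))
    ≡⟨ ≡.cong₂ _+_ (≡.cong₂ _+_ (above (R-supportedIn-tight n) _ ℕₚ.≤-refl) (Q-top (suc n))) (Q-subtop n) ⟩
  suc (suc n) + 2  ∎
  where open ≡.≡-Reasoning

R-subtop : ∀ n → R (suc (suc (suc (suc n)))) (suc (double (suc (suc n)))) ≡ suc (suc (suc (suc n))) + 2
R-subtop n = begin
  R (suc (suc (suc (suc n)))) (suc (double (suc (suc n))))
    ≡⟨ R-suc (suc (suc n)) (suc (double (suc (suc n)))) ⟩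
  R (suc (suc (suc n))) (double (suc (suc n)))
    + (R (suc (suc (suc n))) (double (suc (suc n))) + Q (suc (suc n)) (suc (double (suc n))))
    ≡⟨ ≡.cong₂ _+_ (R-top n) (≡.cong₂ _+_ (R-top n) (Q-subtop (suc n))) ⟩
  suc (suc (suc (suc n))) + 2  ∎
  where open ≡.≡-Reasoning

lowest-coefficients : ∀ n → Q n n ≡ fib (suc (suc (double n))) × R (suc n) (suc n) ≡ fib (suc (suc (suc (double n))))
lowest-coefficients zero    = Q-zero 0 , ≡.trans (R-one 1) (≡.cong₂ _+_ (Q-zero 0) (Q-zero 0))
lowest-coefficients (suc n) = Qₙ₊₁ , Rₙ₊₂
  where
  open ≡.≡-Reasoning
  Qₙ : Q n n ≡ fib (suc (suc (double n)))
  Qₙ = proj₁ (lowest-coefficients n)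
  Rₙ₊₁ : R (suc n) (suc n) ≡ fib (suc (suc (suc (double n))))
  Rₙ₊₁ = proj₂ (lowest-coefficients n)
  Qₙ₊₁ : Q (suc n) (suc n) ≡ fib (suc (suc (double (suc n))))
  Qₙ₊₁ = begin
    Q (suc n) (suc n)
      ≡⟨ Q-suc n (suc n) ⟩
    R (suc n) (suc n) + Q n n + shift (Q n) n
      ≡⟨ ≡.cong₂ _+_ (≡.cong₂ _+_ Rₙ₊₁ Qₙ) (below (supportedIn-shift (Q-supportedIn n)) n ℕₚ.≤-refl) ⟩
    fib (suc (suc (suc (double n)))) + fib (suc (suc (double n))) + 0
      ≡⟨ ℕₚ.+-identityʳ _ ⟩
    fib (suc (suc (double (suc n))))  ∎
  Rₙ₊₂ : R (suc (suc n)) (suc (suc n)) ≡ fib (suc (suc (suc (double (suc n)))))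
  Rₙ₊₂ = begin
    R (suc (suc n)) (suc (suc n))
      ≡⟨ R-suc n (suc (suc n)) ⟩
    R (suc n) (suc n) + (R (suc n) (suc n) + Q n n)
      ≡⟨ ≡.cong₂ _+_ Rₙ₊₁ (≡.cong₂ _+_ Rₙ₊₁ Qₙ) ⟩
    fib (suc (suc (suc (double n)))) + fib (suc (suc (suc (suc (double n)))))
      ≡⟨ ℕₚ.+-comm (fib (suc (suc (suc (double n))))) _ ⟩
    fib (suc (suc (suc (double (suc n)))))  ∎

fib-suc≢0 : ∀ n → fib (suc n) ≢ 0
fib-suc≢0 zero    ()
fib-suc≢0 (suc n) eq = fib-suc≢0 n (ℕₚ.m+n≡0⇒m≡0 _ eq)

Q-claims : ∀ m → let n = suc m in
  (MonicOfDegree (Q n) (2 * n) × LowestDegree (Q n) n) × (Q n (2 * n ∸ 1) ≡ n + 2) × (Q n n ≡ fib (2 * n + 2))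
Q-claims m =
  ((≡.subst (λ d → Q n d ≡ 1) 2n≡ (Q-top n) , λ k 2n<k → above Q∈ k (≡.subst (_< k) (≡.sym 2n≡) 2n<k)) ,
   (fib-suc≢0 (suc (double n)) ∘ ≡.trans (≡.sym Qₙ) , below Q∈)) ,
  ≡.subst (λ d → Q n (d ∸ 1) ≡ n + 2) 2n≡ (Q-subtop m) ,
  ≡.trans Qₙ (≡.cong fib (≡.trans (ℕₚ.+-comm 2 (double n)) (≡.cong (_+ 2) 2n≡)))
  where
  n : ℕ
  n = suc m
  2n≡ : double n ≡ 2 * n
  2n≡ = double≡2* n
  Q∈ : SupportedIn (Q n) n (double n)
  Q∈ = Q-supportedIn n
  Qₙ : Q n n ≡ fib (suc (suc (double n)))
  Qₙ = proj₁ (lowest-coefficients n)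

R-claims : ∀ m → let n = suc (suc (suc m)) in
  (MonicOfDegree (R n) (2 * n ∸ 2) × LowestDegree (R n) n) ×
  (4 ≤ n → R n (2 * n ∸ 3) ≡ n + 2) × (R n n ≡ fib (2 * n + 1))
R-claims m =
  ((≡.subst (λ d → R n (d ∸ 2) ≡ 1) 2n≡ (R-top m) ,
    λ k 2n-2<k → above R∈ k (≡.subst (λ d → d ∸ 2 < k) (≡.sym 2n≡) 2n-2<k)) ,
   (fib-suc≢0 (suc (suc (double (suc (suc m))))) ∘ ≡.trans (≡.sym Rₙ) , below R∈)) ,
  (λ 4≤n → ≡.subst (λ d → R n (d ∸ 3) ≡ n + 2) 2n≡ (subtop m 4≤n)) ,
  ≡.trans Rₙ (≡.cong fib (≡.trans (ℕₚ.+-comm 1 (double n)) (≡.cong (_+ 1) 2n≡)))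
  where
  n : ℕ
  n = suc (suc (suc m))
  2n≡ : double n ≡ 2 * n
  2n≡ = double≡2* n
  R∈ : SupportedIn (R n) n (double (suc (suc m)))
  R∈ = R-supportedIn-tight (suc m)
  Rₙ : R n n ≡ fib (suc (suc (suc (double (suc (suc m))))))
  Rₙ = proj₂ (lowest-coefficients (suc (suc m)))
  subtop : ∀ m → 4 ≤ suc (suc (suc m)) →
           R (suc (suc (suc m))) (double (suc (suc (suc m))) ∸ 3) ≡ suc (suc (suc m)) + 2
  subtop zero    (s≤s (s≤s (s≤s ())))
  subtop (suc m) _ = R-subtop m

lemma5p2 : (∀ (n : ℕ) → 1 ≤ n →
    (MonicOfDegree (Q n) (2 * n) × LowestDegree (Q n) n)
    × (Q n (2 * n ∸ 1) ≡ n + 2)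
    × (Q n n ≡ fib (2 * n + 2)))
    ×
    (∀ (n : ℕ) → 3 ≤ n →
    (MonicOfDegree (R n) (2 * n ∸ 2) × LowestDegree (R n) n)
    × (4 ≤ n → R n (2 * n ∸ 3) ≡ n + 2)
    × (R n n ≡ fib (2 * n + 1)))
lemma5p2 = (λ { zero () ; (suc m) _ → Q-claims m })
         , (λ { zero () ; (suc zero) (s≤s ()) ; (suc (suc zero)) (s≤s (s≤s ()))
              ; (suc (suc (suc m))) _ → R-claims m })
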